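{- Player $I$ has a winning strategy in $G_{fin}(conv)$.
   Context: For an ideal $\mathcal{I}$ on a countable set $X$, the game $G_{fin}(\mathcal{I})$: player $I$ starts with a partition $X=A^0_0\cup A^0_1$, player $II$ answers with $i_0\in2$ and a finite $a_0\subseteq A^0_{i_0}$; in move $n+1$ player $I$ partitions the previously chosen piece $A^n_{i_n}$ into $A^{n+1}_0\cup A^{n+1}_1$ and player $II$ answers with $i_{n+1}\in 2$ and a finite $a_{n+1}\subseteq A^{n+1}_{i_{n+1}}$. Player $I$ wins if $\bigcup_n a_n\in\mathcal{I}$, otherwise player $II$ wins. $conv$ is the ideal on $\mathbb{Q}\cap[0,1]$ generated by the sequences of rationals in $[0,1]$ that converge (in $[0,1]$). -}

module Defs where

open import Data.Nat using (ℕ; _≤_)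
open import Data.Bool using (Bool)
open import Data.List using (List; map; upTo)
open import Data.List.Membership.Propositional using (_∈_)
open import Data.List.Relation.Unary.All using (All)
open import Data.List.Relation.Unary.Any using (Any)
open import Data.Product using (Σ; _×_; ∃; proj₁; proj₂)
open import Data.Rational using (ℚ; 0ℚ; 1ℚ; Positive; ∣_∣; _-_) renaming (_≤_ to _≤ℚ_)
open import Relation.Binary.PropositionalEquality using (_≡_)
open import Level using (0ℓ)
open import Relation.Unary using (Pred)

X : Set
X = Σ ℚ (λ q → (0ℚ ≤ℚ q) × (q ≤ℚ 1ℚ))

val : X → ℚ
val = proj₁

Seq : Set
Seq = ℕ → X

-- A sequence of rationals in [0,1] converges in [0,1] iff it is Cauchy
-- ([0,1] is complete); there are no reals in the library.
Converges : Seq → Set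
Converges s = ∀ (ε : ℚ) → Positive ε →
  ∃ λ N → ∀ m n → N ≤ m → N ≤ n → ∣ val (s m) - val (s n) ∣ ≤ℚ ε

InRange : Seq → X → Set
InRange s x = ∃ λ k → val (s k) ≡ val x

-- The ideal conv: generated by ranges of convergent sequences, i.e.
-- A ∈ conv iff A is covered by finitely many convergent sequences.
InConv : Pred X 0ℓ → Set
InConv A = Σ (List Seq) λ ss →
  All Converges ss × (∀ x → A x → Any (λ s → InRange s x) ss)

-- The game G_fin(conv).
-- A move of player II: a side i ∈ 2 and a finite set a (given as a list).
MoveII : Set
MoveII = Bool × List X

-- A strategy of player I: given the moves of II so far, a partition of X
-- into two pieces, encoded by a map X → Bool (piece A_0 = false-part,
-- A_1 = true-part). Only its restriction to the current piece matters.
StrategyI : Set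
StrategyI = List MoveII → (X → Bool)

PlayII : Set
PlayII = ℕ → MoveII

history : PlayII → ℕ → List MoveII
history p n = map p (upTo n)

side : PlayII → ℕ → Bool
side p n = proj₁ (p n)

chosen : PlayII → ℕ → List X
chosen p n = proj₂ (p n)

partitionAt : StrategyI → PlayII → ℕ → (X → Bool)
partitionAt σ p n = σ (history p n)

InPiece : StrategyI → PlayII → ℕ → X → Set
InPiece σ p n x = ∀ k → k ≤ n → partitionAt σ p k x ≡ side p k

Legal : StrategyI → PlayII → Set
Legal σ p = ∀ n x → x ∈ chosen p n → InPiece σ p n x

UnionChosen : PlayII → Pred X 0ℓ
UnionChosen p x = ∃ λ n → x ∈ chosen p n

WinningI : StrategyI → Set
WinningI σ = ∀ (p : PlayII) → Legal σ p → InConv (UnionChosen p)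

{-# OPTIONS --safe #-}

-- Player I bisects: the n-th partition splits the current dyadic cell, of
-- width 2⁻ⁿ, at its midpoint, so whatever II picks at stage n lies in a cell
-- of width 2⁻⁽ⁿ⁺¹⁾ and these cells are nested.  Enumerating a₀, a₁, … in
-- order, each block preceded by the left endpoint of its cell so that the
-- enumeration never runs dry, gives a single sequence covering ⋃ aₙ whose
-- terms after block M all lie in the M-th cell: it is Cauchy.

module Submission where

open import Defs
open import Data.Bool using (Bool; true; false; if_then_else_)
open import Data.Integer using (+_; +≤+)
open import Data.List using (List; []; _∷_; _∷ʳ_; map; foldl; upTo; applyUpTo)
open import Data.List.Membership.Propositional using (_∈_)
open import Data.List.NonEmpty using (List⁺; _∷_; head; tail; toList)
open import Data.List.Properties using (foldl-∷ʳ; applyUpTo-∷ʳ; map-∘; map-upTo)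
open import Data.List.Relation.Unary.All as All using (All; []; _∷_)
open import Data.List.Relation.Unary.Any using (here; there)
open import Data.Nat as ℕ using (ℕ; zero; suc; z≤n; s≤s; _≤′_; ≤′-refl; ≤′-step)
import Data.Nat.Properties as ℕ
open import Data.Nat.Coprimality using (1-coprimeTo)
open import Data.Product using (∃; _×_; _,_; proj₁; proj₂)
open import Data.Rational
  using (ℚ; mkℚ; ↧ₙ_; 0ℚ; 1ℚ; ½; _+_; _*_; -_; _-_; ∣_∣; _≤_; *≤*; Positive)
open import Data.Rational.Properties
open import Data.Rational.Solver using (module +-*-Solver)
open import Data.Sum using (inj₁; inj₂)
open import Function using (_∘_)
open import Relation.Nullary using (Dec; does; yes; no)
open import Relation.Binary.PropositionalEquality

½^ : ℕ → ℚ
½^ zero    = 1ℚ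
½^ (suc k) = ½ * ½^ k

½^-nonNeg : ∀ k → 0ℚ ≤ ½^ k
½^-nonNeg zero    = nonNegative⁻¹ 1ℚ
½^-nonNeg (suc k) = *-monoˡ-≤-nonNeg ½ (½^-nonNeg k)

-- 1 / (d + 1)
unitFraction : ℕ → ℚ
unitFraction d = mkℚ (+ 1) d (1-coprimeTo (suc d))

½*unitFraction : ∀ d → ½ * unitFraction d ≡ unitFraction (1 ℕ.+ 2 ℕ.* d)
½*unitFraction d =
  trans (normalize-coprime (1-coprimeTo _)) (cong unitFraction (ℕ.+-suc d (d ℕ.+ 0)))

½^-unitFraction : ∀ k → ∃ λ d → k ℕ.≤ d × ½^ k ≡ unitFraction d
½^-unitFraction zero = 0 , z≤n , refl
½^-unitFraction (suc k) with ½^-unitFraction k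
... | d , k≤d , ½^k≡ =
  1 ℕ.+ 2 ℕ.* d , s≤s (ℕ.≤-trans k≤d (ℕ.m≤m+n d _)) ,
  trans (cong (½ *_) ½^k≡) (½*unitFraction d)

unitFraction-≤ : ∀ ε → Positive ε → ∀ {d} → ↧ₙ ε ℕ.≤ suc d → unitFraction d ≤ ε
unitFraction-≤ (mkℚ (+ suc n) e _) _ {d} e<1+d =
  *≤* (+≤+ (ℕ.≤-trans (ℕ.≤-reflexive (ℕ.*-identityˡ (suc e)))
                      (ℕ.≤-trans e<1+d (ℕ.m≤n*m (suc d) (suc n)))))

½^-small : ∀ ε → Positive ε → ∃ λ k → ½^ k ≤ ε
½^-small ε ε>0 with ½^-unitFraction (↧ₙ ε)
... | d , ↧ε≤d , ½^≡ =
  ↧ₙ ε , subst (_≤ ε) (sym ½^≡) (unitFraction-≤ ε ε>0 (ℕ.m≤n⇒m≤1+n ↧ε≤d))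

record Interval : Set where
  field
    left  : ℚ
    width : ℚ
open Interval

infix 4 _∈ᴵ_
_∈ᴵ_ : ℚ → Interval → Set
x ∈ᴵ I = left I ≤ x × x ≤ left I + width I

unitInterval : Interval
unitInterval = record { left = 0ℚ ; width = 1ℚ }

midpoint : Interval → ℚ
midpoint I = left I + ½ * width I

bisect : Interval → Bool → Interval
bisect I b = record { left = if b then midpoint I else left I ; width = ½ * width I }

halfOf : Interval → ℚ → Bool
halfOf I x = does (midpoint I ≤? x)

midpoint-+½ : ∀ I → midpoint I + ½ * width I ≡ left I + width I
midpoint-+½ I =
  solve 2 (λ l w → (l :+ con ½ :* w) :+ con ½ :* w := l :+ w) refl (left I) (width I)
  where open +-*-Solver

p≤p+q : ∀ {p q} → 0ℚ ≤ q → p ≤ p + q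
p≤p+q {p} 0≤q = subst (_≤ p + _) (+-identityʳ p) (+-monoʳ-≤ p 0≤q)

left≤midpoint : ∀ I → 0ℚ ≤ width I → left I ≤ midpoint I
left≤midpoint I 0≤w = p≤p+q (*-monoˡ-≤-nonNeg ½ 0≤w)

midpoint≤right : ∀ I → 0ℚ ≤ width I → midpoint I ≤ left I + width I
midpoint≤right I 0≤w =
  subst (midpoint I ≤_) (midpoint-+½ I) (p≤p+q (*-monoˡ-≤-nonNeg ½ 0≤w))

left-∈ : ∀ I → 0ℚ ≤ width I → left I ∈ᴵ I
left-∈ I 0≤w = ≤-refl , p≤p+q 0≤w

∈-bisect-halfOf : ∀ {I x} → x ∈ᴵ I → x ∈ᴵ bisect I (halfOf I x)
∈-bisect-halfOf {I} {x} (l≤x , x≤r) = by-side (midpoint I ≤? x)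
  where
  by-side : (m≤?x : Dec (midpoint I ≤ x)) → x ∈ᴵ bisect I (does m≤?x)
  by-side (yes m≤x) = m≤x , subst (x ≤_) (sym (midpoint-+½ I)) x≤r
  by-side (no  m≰x) = l≤x , <⇒≤ (≰⇒> m≰x)

bisect-⊆ : ∀ {I x} b → 0ℚ ≤ width I → x ∈ᴵ bisect I b → x ∈ᴵ I
bisect-⊆ {I} true  0≤w (m≤x , x≤r) =
  ≤-trans (left≤midpoint I 0≤w) m≤x , subst (_ ≤_) (midpoint-+½ I) x≤r
bisect-⊆ {I} false 0≤w (l≤x , x≤m) = l≤x , ≤-trans x≤m (midpoint≤right I 0≤w)

∈-difference : ∀ {I x y} → x ∈ᴵ I → y ∈ᴵ I → x - y ≤ width I
∈-difference {I} {x} {y} (_ , x≤r) (l≤y , _) =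
  subst (x - y ≤_) (right-left (left I) (width I)) (+-mono-≤ x≤r (neg-antimono-≤ l≤y))
  where
  right-left : ∀ l w → l + w - l ≡ w
  right-left = solve 2 (λ l w → (l :+ w) :- l := w) refl
    where open +-*-Solver

∈-dist : ∀ {I x y} → x ∈ᴵ I → y ∈ᴵ I → ∣ x - y ∣ ≤ width I
∈-dist {I} {x} {y} x∈I y∈I with ∣p∣≡p∨∣p∣≡-p (x - y)
... | inj₁ ∣x-y∣≡x-y  = subst (_≤ width I) (sym ∣x-y∣≡x-y) (∈-difference x∈I y∈I)
... | inj₂ ∣x-y∣≡y-x =
  subst (_≤ width I) (sym (trans ∣x-y∣≡y-x (neg-difference x y))) (∈-difference y∈I x∈I)
  where
  neg-difference : ∀ a b → - (a - b) ≡ b - a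
  neg-difference = solve 2 (λ a b → :- (a :- b) := b :- a) refl
    where open +-*-Solver

cellAt : (ℕ → Bool) → ℕ → Interval
cellAt s zero    = unitInterval
cellAt s (suc n) = bisect (cellAt s n) (s n)

width-cellAt : ∀ s n → width (cellAt s n) ≡ ½^ n
width-cellAt s zero    = refl
width-cellAt s (suc n) = cong (½ *_) (width-cellAt s n)

cellAt-width-nonNeg : ∀ s n → 0ℚ ≤ width (cellAt s n)
cellAt-width-nonNeg s n = subst (0ℚ ≤_) (sym (width-cellAt s n)) (½^-nonNeg n)

cellAt-antitone : ∀ s {m n x} → m ℕ.≤ n → x ∈ᴵ cellAt s n → x ∈ᴵ cellAt s m
cellAt-antitone s {x = x} m≤n = go (ℕ.≤⇒≤′ m≤n)
  where
  go : ∀ {m n} → m ≤′ n → x ∈ᴵ cellAt s n → x ∈ᴵ cellAt s m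
  go ≤′-refl            x∈ = x∈
  go (≤′-step {n} m≤′n) x∈ = go m≤′n (bisect-⊆ (s n) (cellAt-width-nonNeg s n) x∈)

∈-cellAt : ∀ s n {x} → x ∈ᴵ unitInterval →
           (∀ k → k ℕ.< n → halfOf (cellAt s k) x ≡ s k) → x ∈ᴵ cellAt s n
∈-cellAt s zero    x∈ _       = x∈
∈-cellAt s (suc n) {x} x∈ follows =
  subst (λ b → x ∈ᴵ bisect (cellAt s n) b) (follows n ℕ.≤-refl)
    (∈-bisect-halfOf (∈-cellAt s n x∈ (λ k k<n → follows k (ℕ.m<n⇒m<1+n k<n))))

corner : (ℕ → Bool) → ℕ → X
corner s n = left (cellAt s n) ,
  cellAt-antitone s (z≤n {n}) (left-∈ (cellAt s n) (cellAt-width-nonNeg s n))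

cell : List Bool → Interval
cell = foldl bisect unitInterval

cell-applyUpTo : ∀ s n → cell (applyUpTo s n) ≡ cellAt s n
cell-applyUpTo s zero    = refl
cell-applyUpTo s (suc n) = begin
  cell (applyUpTo s (suc n))             ≡⟨ cong cell (applyUpTo-∷ʳ s n) ⟨
  cell (applyUpTo s n ∷ʳ s n)            ≡⟨ foldl-∷ʳ bisect unitInterval (s n) (applyUpTo s n) ⟩
  bisect (cell (applyUpTo s n)) (s n)    ≡⟨ cong (λ I → bisect I (s n)) (cell-applyUpTo s n) ⟩
  cellAt s (suc n)                       ∎
  where open ≡-Reasoning

module _ {A : Set} where

  -- The sequence xs ++ b 0 ++ b 1 ++ ⋯, infinite because the blocks are non-empty.
  flatten : List A → (ℕ → List⁺ A) → ℕ → A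
  flatten (x ∷ xs) b zero    = x
  flatten (x ∷ xs) b (suc k) = flatten xs b k
  flatten []       b zero    = head (b 0)
  flatten []       b (suc k) = flatten (tail (b 0)) (b ∘ suc) k

  flatten-prefix : ∀ {x xs} b → x ∈ xs → ∃ λ k → flatten xs b k ≡ x
  flatten-prefix b (here refl) = zero , refl
  flatten-prefix b (there x∈)  = let k , eq = flatten-prefix b x∈ in suc k , eq

  flatten-first : ∀ {x} b → x ∈ toList (b 0) → ∃ λ k → flatten [] b k ≡ x
  flatten-first b (here refl) = zero , refl
  flatten-first b (there x∈)  = let k , eq = flatten-prefix (b ∘ suc) x∈ in suc k , eq

  flatten-shift : ∀ M xs b → ∃ λ N → ∀ k → flatten xs b (N ℕ.+ k) ≡ flatten [] (b ∘ (M ℕ.+_)) k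
  flatten-shift M       (x ∷ xs) b = let N , shift = flatten-shift M xs b in suc N , shift
  flatten-shift zero    []       b = zero , λ k → refl
  flatten-shift (suc M) []       b =
    let N , shift = flatten-shift M (tail (b 0)) (b ∘ suc) in suc N , shift

  flatten-all : ∀ {P : A → Set} {xs b} → All P xs → (∀ n → All P (toList (b n))) →
                ∀ k → P (flatten xs b k)
  flatten-all (px ∷ _)   _  zero    = px
  flatten-all (_  ∷ pxs) pb (suc k) = flatten-all pxs pb k
  flatten-all []         pb zero    = All.head (pb 0)
  flatten-all []         pb (suc k) = flatten-all (All.tail (pb 0)) (pb ∘ suc) k

  flatten-covers : ∀ {x} b n → x ∈ toList (b n) → ∃ λ k → flatten [] b k ≡ x
  flatten-covers {x} b n x∈ =
    let N , shift = flatten-shift n [] b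
        k , eq    = flatten-first (b ∘ (n ℕ.+_))
                      (subst (λ i → x ∈ toList (b i)) (sym (ℕ.+-identityʳ n)) x∈)
    in N ℕ.+ k , trans (shift k) eq

  flatten-eventually : ∀ {P : A → Set} b M → (∀ n → All P (toList (b (M ℕ.+ n)))) →
                       ∃ λ N → ∀ k → N ℕ.≤ k → P (flatten [] b k)
  flatten-eventually {P} b M pb =
    let N , shift = flatten-shift M [] b
    in N , λ k N≤k → subst (P ∘ flatten [] b) (ℕ.m+[n∸m]≡n N≤k)
                       (subst P (sym (shift (k ℕ.∸ N))) (flatten-all [] pb (k ℕ.∸ N)))

bisection : StrategyI
bisection h x = halfOf (cell (map proj₁ h)) (val x)

cell-history : ∀ p n → cell (map proj₁ (history p n)) ≡ cellAt (side p) n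
cell-history p n = begin
  cell (map proj₁ (map p (upTo n)))  ≡⟨ cong cell (map-∘ (upTo n)) ⟨
  cell (map (side p) (upTo n))       ≡⟨ cong cell (map-upTo (side p) n) ⟩
  cell (applyUpTo (side p) n)        ≡⟨ cell-applyUpTo (side p) n ⟩
  cellAt (side p) n                  ∎
  where open ≡-Reasoning

InPiece⇒∈cellAt : ∀ p n {x} → InPiece bisection p n x → val x ∈ᴵ cellAt (side p) (suc n)
InPiece⇒∈cellAt p n {x} inPiece = ∈-cellAt (side p) (suc n) (proj₂ x) λ k k<1+n →
  trans (cong (λ I → halfOf I (val x)) (sym (cell-history p k))) (inPiece k (ℕ.≤-pred k<1+n))

module _ (p : PlayII) where

  block : ℕ → List⁺ X
  block n = corner (side p) (suc n) ∷ chosen p n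

  enumeration : Seq
  enumeration = flatten [] block

  block-⊆-cellAt : Legal bisection p → ∀ n →
                   All (λ x → val x ∈ᴵ cellAt (side p) (suc n)) (toList (block n))
  block-⊆-cellAt legal n =
    left-∈ (cellAt (side p) (suc n)) (cellAt-width-nonNeg (side p) (suc n)) ∷
    All.tabulate (λ {x} x∈ → InPiece⇒∈cellAt p n {x} (legal n x x∈))

  enumeration-converges : Legal bisection p → Converges enumeration
  enumeration-converges legal ε ε>0 =
    let M , ½^M≤ε   = ½^-small ε ε>0
        N , inCellM = flatten-eventually block M λ n →
          All.map (cellAt-antitone (side p) (ℕ.m≤n⇒m≤1+n (ℕ.m≤m+n M n)))
                  (block-⊆-cellAt legal (M ℕ.+ n))
    in N , λ m n N≤m N≤n →
      ≤-trans (∈-dist {cellAt (side p) M} (inCellM m N≤m) (inCellM n N≤n))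
              (subst (_≤ ε) (sym (width-cellAt (side p) M)) ½^M≤ε)

  enumeration-covers : ∀ x → UnionChosen p x → InRange enumeration x
  enumeration-covers x (n , x∈aₙ) =
    let k , eq = flatten-covers block n (there x∈aₙ) in k , cong val eq

proposition3p6 : ∃ λ (σ : StrategyI) → WinningI σ
proposition3p6 = bisection , λ p legal →
  enumeration p ∷ [] , enumeration-converges p legal ∷ [] ,
  λ x x∈⋃aₙ → here (enumeration-covers p x x∈⋃aₙ)
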